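{- Let $S$ be an admissible pinnacle set and let $\mathcal{A}$ be an ordering of the elements of $S$. Then $\mathcal{A}$ is an admissible ordering of $S$ if and only if, for each $x \in S$, the set $S_x = [1,x]\cap S$ is interrupted at most $k_x := |\overline{S}_x| - |S_x| - 1$ times in $\mathcal{A}$, where $\overline{S}_x = [1,x]\setminus S$.
   Context: A permutation $w = w(1)w(2)\cdots w(n)$ of $[n]$ has a pinnacle $w(i)$ whenever $i \in [2,n-1]$ and $w(i-1) < w(i) > w(i+1)$; $\mathrm{Pin}(w)$ denotes the set of pinnacles. A set $S$ of positive integers is an admissible pinnacle set if $S = \mathrm{Pin}(w)$ for some permutation $w$ (of some $[n]$). An ordering of $S$ is admissible if there is a permutation $w$ with $\mathrm{Pin}(w)=S$ whose pinnacles appear (left to right in $w$) in that order. For $x$ a positive integer, $S_x := [1,x]\cap S$ and $\overline{S}_x := [1,x]\setminus S$. Interruption: given a subset $T \subseteq S$ and an ordering $\mathcal{A}$ of $S$, write $\mathcal{A}$ as a word $a_0 t_1 a_1 t_2 \cdots a_{k-1} t_k a_k$ where each $t_i$ is a nonempty word of elements of $T$, each $a_i$ is a word of elements of $S\setminus T$, and only $a_0$ and $a_k$ may be empty; then $T$ is interrupted $k-1$ times in $\mathcal{A}$ (uninterrupted if $k=1$). -}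

module Defs where

open import Data.Bool using (Bool; true; false; if_then_else_; _∧_; not)
open import Data.Nat using (ℕ; zero; suc; _≤_; _<?_; _≤?_; _∸_)
open import Data.Nat.Properties using (_≟_)
open import Data.List using (List; []; _∷_; map; upTo; filter; length)
open import Data.List.Relation.Binary.Permutation.Propositional using (_↭_)
open import Data.List.Membership.Propositional using (_∈_)
open import Data.List.Membership.DecPropositional _≟_ using (_∈?_)
open import Data.Product using (Σ; _×_; ∃)
open import Relation.Binary.PropositionalEquality using (_≡_)
open import Data.Integer as ℤ using (ℤ; +_)
open import Function.Bundles using (_⇔_)
open import Relation.Nullary using (does; ¬?)

interval : ℕ → List ℕ
interval n = map suc (upTo n)

IsPerm : ℕ → List ℕ → Set
IsPerm n w = w ↭ interval n

pins : List ℕ → List ℕ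
pins (a ∷ b ∷ c ∷ rest) =
  if does (a <? b) ∧ does (c <? b)
  then b ∷ pins (b ∷ c ∷ rest)
  else pins (b ∷ c ∷ rest)
pins _ = []

_∈Pin_ : ℕ → List ℕ → Set
y ∈Pin w = y ∈ pins w

-- S (a finite set given as a duplicate-free list) is an admissible pinnacle set
AdmissiblePinnacleSet : List ℕ → Set
AdmissiblePinnacleSet S =
  ∃ λ n → Σ (List ℕ) λ w → IsPerm n w × (∀ y → (y ∈Pin w) ⇔ (y ∈ S))

-- the ordering A (a word listing the elements of S) is admissible:
-- some permutation w has Pin(w) = S with pinnacles appearing in the order A
AdmissibleOrdering : List ℕ → Set
AdmissibleOrdering A = ∃ λ n → Σ (List ℕ) λ w → IsPerm n w × pins w ≡ A

-- number of maximal nonempty blocks (the t_i's) of consecutive letters of A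
-- satisfying the predicate T, i.e. the k in  a₀ t₁ a₁ … t_k a_k
-- (the flag records whether the previous letter was in T)
blocksFrom : (ℕ → Bool) → Bool → List ℕ → ℕ
blocksFrom T prev [] = 0
blocksFrom T prev (a ∷ as) with T a
... | true  = (if prev then 0 else 1) Data.Nat.+ blocksFrom T true as
... | false = blocksFrom T false as

blocks : (ℕ → Bool) → List ℕ → ℕ
blocks T A = blocksFrom T false A

interruptions : (ℕ → Bool) → List ℕ → ℕ
interruptions T A = blocks T A ∸ 1

-- the subset S_x = [1,x] ∩ S, as a predicate on the letters of an ordering of S
inSx : ℕ → ℕ → Bool
inSx x y = does (y ≤? x)

cardSx : List ℕ → ℕ → ℕ
cardSx S x = length (filter (λ y → y ≤? x) S)

cardSbarx : List ℕ → ℕ → ℕ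
cardSbarx S x = length (filter (λ y → ¬? (y ∈? S)) (interval x))

kx : List ℕ → ℕ → ℤ
kx S x = (+ cardSbarx S x) ℤ.- (+ cardSx S x) ℤ.- + 1

-- If w is a permutation of [n] and x ≤ n, each block of m consecutive pinnacles ≤ x of w
-- needs m + 1 distinct valleys ≤ x around it, so 2|S_x| + b_x ≤ x = |S_x| + |S̄_x|, where b_x
-- is the number of blocks of S_x in the ordering; that is |S_x| + b_x ≤ |S̄_x|, which is the
-- interruption bound. Conversely, an ordering p₁ … pₖ is realised by v₀ p₁ v₁ … pₖ vₖ followed
-- by the unused values in increasing order, as soon as the valleys vᵢ are distinct
-- non-pinnacles below the ceilings p₁, p₁ ⊓ p₂, …, pₖ₋₁ ⊓ pₖ, pₖ. Exactly |S_t| + b_t ceilings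
-- are ≤ t, so the interruption bound is Hall's condition for choosing the valleys, and a
-- greedy choice succeeds.
module Submission where

module PinnacleOrderings where

  open import Defs
  open import Data.Bool using (Bool; true; false; if_then_else_; _∧_; _∨_)
  open import Data.Bool.Properties using (∧-zeroʳ)
  open import Data.Empty using (⊥-elim)
  import Data.Integer as ℤ
  import Data.Integer.Properties as ℤ
  import Data.Integer.Tactic.RingSolver as ℤ-Solver
  open import Data.List using (List; []; _∷_; _++_; filter; length; map; upTo)
  open import Data.List.Properties
    using (filter-accept; filter-reject; filter-++; filter-none; length-++; length-map; length-upTo; ++-assoc)
  open import Data.List.Membership.Propositional using (_∈_)
  open import Data.List.Membership.Propositional.Properties
    using (∈-filter⁺; ∈-filter⁻; ∈-map⁺; ∈-map⁻; ∈-upTo⁺; ∈-upTo⁻; ∈-++⁺ʳ)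
  open import Data.List.Membership.Propositional.Properties.WithK using (unique∧set⇒bag)
  open import Data.List.Relation.Binary.BagAndSetEquality using (∼bag⇒↭)
  open import Data.List.Relation.Binary.Permutation.Propositional
    using (_↭_; ↭-refl; ↭-sym; ↭-trans; prep; module PermutationReasoning)
  open import Data.List.Relation.Binary.Permutation.Propositional.Properties
    using (shift; ∈-resp-↭; filter-↭; ↭-length; ++⁺; ++⁺ʳ)
  open import Data.List.Relation.Binary.Pointwise as Pointwise using (Pointwise; []; _∷_)
  open import Data.List.Relation.Unary.All as All using (All; []; _∷_)
  import Data.List.Relation.Unary.All.Properties as All
  open import Data.List.Relation.Unary.AllPairs using (_∷_)
  open import Data.List.Relation.Unary.Any using (here; there)
  open import Data.List.Relation.Unary.Linked as Linked using (Linked; []; [-]; _∷_)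
  import Data.List.Relation.Unary.Linked.Properties as Linked
  open import Data.List.Relation.Unary.Unique.Propositional using (Unique)
  import Data.List.Relation.Unary.Unique.Propositional.Properties as Unique
  open import Data.Nat
  open import Data.Nat.ListAction using (sum)
  open import Data.List.Membership.DecPropositional _≟_ using (_∈?_)
  open import Data.Nat.Properties
  open import Data.Nat.Tactic.RingSolver using (solve-∀)
  open import Data.Sum using (_⊎_; inj₁; inj₂; [_,_]′)
  open import Data.Product using (∃; ∃₂; _×_; _,_; proj₁; proj₂)
  open import Function using (id; _∘_)
  open import Function.Bundles using (_⇔_; mk⇔; Equivalence)
  open import Relation.Binary.PropositionalEquality
  open import Relation.Nullary using (¬_; yes; no; does; ¬?)
  open import Relation.Nullary.Decidable using (dec-true; dec-false)
  open import Relation.Unary using (Pred; Decidable)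

  private variable
    a b c p t u v x y n : ℕ
    f : Bool
    as bs cs l r vs xs ys U : List ℕ

  pins-notPeakˡ : ¬ a < b → pins (a ∷ b ∷ c ∷ r) ≡ pins (b ∷ c ∷ r)
  pins-notPeakˡ {a = a} {b = b} a≮b rewrite dec-false (a <? b) a≮b = refl

  pins-notPeakʳ : ¬ c < b → pins (a ∷ b ∷ c ∷ r) ≡ pins (b ∷ c ∷ r)
  pins-notPeakʳ {c = c} {b = b} {a = a} c≮b
    rewrite dec-false (c <? b) c≮b | ∧-zeroʳ (does (a <? b)) = refl

  pins-descent : c < b → pins (b ∷ c ∷ r) ≡ pins (c ∷ r)
  pins-descent {r = []}    c<b = refl
  pins-descent {r = _ ∷ r} c<b = pins-notPeakˡ {r = r} (<-asym c<b)

  pins-peak : a < b → c < b → pins (a ∷ b ∷ c ∷ r) ≡ b ∷ pins (c ∷ r)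
  pins-peak {a = a} {b = b} {c = c} {r = r} a<b c<b
    rewrite dec-true (a <? b) a<b | dec-true (c <? b) c<b = cong (b ∷_) (pins-descent {r = r} c<b)

  pins-increasing : Linked _<_ xs → pins (v ∷ xs) ≡ []
  pins-increasing {[]}        _              = refl
  pins-increasing {_ ∷ []}    _              = refl
  pins-increasing {_ ∷ _ ∷ ys} (y<y′ ∷ ys↑) = trans (pins-notPeakʳ {r = ys} (<-asym y<y′)) (pins-increasing ys↑)

  ∈-if-∷⁻ : ∀ B → y ∈ (if B then b ∷ l else l) → y ≡ b ⊎ y ∈ l
  ∈-if-∷⁻ true  (here y≡b) = inj₁ y≡b
  ∈-if-∷⁻ true  (there y∈) = inj₂ y∈
  ∈-if-∷⁻ false y∈         = inj₂ y∈

  ∈-pins⇒∈ : ∀ w → y ∈ pins w → y ∈ w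
  ∈-pins⇒∈ (_ ∷ _ ∷ []) ()
  ∈-pins⇒∈ (a ∷ b ∷ c ∷ r) y∈ =
    there ([ (λ { refl → here refl }) , ∈-pins⇒∈ (b ∷ c ∷ r) ]′
             (∈-if-∷⁻ (does (a <? b) ∧ does (c <? b)) y∈))

  blocksFrom-≤ : a ≤ x → blocksFrom (inSx x) f (a ∷ as) ≡ (if f then 0 else 1) + blocksFrom (inSx x) true as
  blocksFrom-≤ {a = a} {x = x} a≤x rewrite dec-true (a ≤? x) a≤x = refl

  blocksFrom-≰ : ¬ a ≤ x → blocksFrom (inSx x) f (a ∷ as) ≡ blocksFrom (inSx x) false as
  blocksFrom-≰ {a = a} {x = x} a≰x rewrite dec-false (a ≤? x) a≰x = refl

  blocksFrom-∷ : ∀ (T : ℕ → Bool) f a as → blocksFrom T f (a ∷ as) ≡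
    (if T a then (if f then 0 else 1) + blocksFrom T true as else blocksFrom T false as)
  blocksFrom-∷ T f a as with T a
  ... | true  = refl
  ... | false = refl

  blocks-pos : y ∈ as → y ≤ x → 0 < blocks (inSx x) as
  blocks-pos {as = a ∷ as} {x = x} y∈ y≤x with a ≤? x
  ... | yes a≤x = subst (0 <_) (sym (blocksFrom-≤ a≤x)) z<s
  ... | no a≰x with y∈
  ...   | here refl  = ⊥-elim (a≰x y≤x)
  ...   | there y∈as = subst (0 <_) (sym (blocksFrom-≰ a≰x)) (blocks-pos y∈as y≤x)

  count≤ count< : ℕ → List ℕ → ℕ
  count≤ t xs = length (filter (_≤? t) xs)
  count< t xs = length (filter (_<? t) xs)

  indicator : Bool → ℕ
  indicator true  = 1
  indicator false = 0

  count≤-∷ : ∀ t a l → count≤ t (a ∷ l) ≡ indicator (inSx t a) + count≤ t l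
  count≤-∷ t a l with inSx t a
  ... | true  = refl
  ... | false = refl

  count≤-accept : a ≤ t → count≤ t (a ∷ l) ≡ suc (count≤ t l)
  count≤-accept {t = t} a≤t = cong length (filter-accept (_≤? t) a≤t)

  count≤-reject : ¬ a ≤ t → count≤ t (a ∷ l) ≡ count≤ t l
  count≤-reject {t = t} a≰t = cong length (filter-reject (_≤? t) a≰t)

  count≤-++ : ∀ t xs ys → count≤ t (xs ++ ys) ≡ count≤ t xs + count≤ t ys
  count≤-++ t xs ys = trans (cong length (filter-++ (_≤? t) xs ys)) (length-++ (filter (_≤? t) xs))

  count≤-↭ : xs ↭ ys → count≤ t xs ≡ count≤ t ys
  count≤-↭ {t = t} xs↭ys = ↭-length (filter-↭ (_≤? t) xs↭ys)

  count≤-insert : ∀ xs → c ≤ t → count≤ t (xs ++ c ∷ ys) ≡ suc (count≤ t (xs ++ ys))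
  count≤-insert {c} {t} {ys} xs c≤t =
    trans (count≤-↭ (shift c xs ys)) (count≤-accept c≤t)

  count<-∷ : ∀ t u U → count< t (u ∷ U) ≤ suc (count< t U)
  count<-∷ t u U with u <? t
  ... | yes u<t = ≤-reflexive (cong length (filter-accept (_<? t) u<t))
  ... | no  u≮t = ≤-trans (≤-reflexive (cong length (filter-reject (_<? t) u≮t))) (n≤1+n _)

  count<-increasing : ¬ u < t → Linked _<_ (u ∷ U) → count< t (u ∷ U) ≡ 0
  count<-increasing {u} {t} u≮t U↑ with Linked.Linked⇒AllPairs <-trans U↑
  ... | u<U ∷ _ = cong length (filter-none (_<? t)
                    (u≮t ∷ All.map (λ u<y y<t → u≮t (<-trans u<y y<t)) u<U))

  unique-↭ : Unique xs → Unique ys → (∀ {z} → z ∈ xs ⇔ z ∈ ys) → xs ↭ ys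
  unique-↭ xs! ys! same = ∼bag⇒↭ (unique∧set⇒bag xs! ys! same)

  filter-partition-↭ : ∀ {ℓ} {P : Pred ℕ ℓ} (P? : Decidable P) xs →
                       xs ↭ filter P? xs ++ filter (λ y → ¬? (P? y)) xs
  filter-partition-↭ P? []       = ↭-refl
  filter-partition-↭ P? (x ∷ xs) with P? x
  ... | yes _ = prep x (filter-partition-↭ P? xs)
  ... | no  _ = ↭-trans (prep x (filter-partition-↭ P? xs)) (↭-sym (shift x (filter P? xs) _))

  ∈-interval⁻ : y ∈ interval n → 1 ≤ y × y ≤ n
  ∈-interval⁻ y∈ with i , i∈ , refl ← ∈-map⁻ suc y∈ = s≤s z≤n , ∈-upTo⁻ i∈

  ∈-interval⁺ : 1 ≤ y → y ≤ n → y ∈ interval n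
  ∈-interval⁺ {suc i} _ y≤n = ∈-map⁺ suc (∈-upTo⁺ y≤n)

  interval-unique : ∀ n → Unique (interval n)
  interval-unique n = Unique.map⁺ suc-injective (Unique.upTo⁺ n)

  interval-increasing : ∀ n → Linked _<_ (interval n)
  interval-increasing n = Linked.map⁺ (Linked.applyUpTo⁺₂ id n (λ i → s≤s (n<1+n i)))

  length-interval : ∀ n → length (interval n) ≡ n
  length-interval n = trans (length-map suc (upTo n)) (length-upTo n)

  count≤-interval : x ≤ n → count≤ x (interval n) ≡ x
  count≤-interval {x} {n} x≤n = trans (↭-length filtered↭) (length-interval x)
    where
    filtered↭ : filter (_≤? x) (interval n) ↭ interval x
    filtered↭ = unique-↭ (Unique.filter⁺ (_≤? x) (interval-unique n)) (interval-unique x) (mk⇔ to from)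
      where
      to : y ∈ filter (_≤? x) (interval n) → y ∈ interval x
      to y∈ with y∈I , y≤x ← ∈-filter⁻ (_≤? x) {xs = interval n} y∈ =
        ∈-interval⁺ (proj₁ (∈-interval⁻ y∈I)) y≤x
      from : y ∈ interval x → y ∈ filter (_≤? x) (interval n)
      from y∈ with 1≤y , y≤x ← ∈-interval⁻ y∈ =
        ∈-filter⁺ (_≤? x) (∈-interval⁺ 1≤y (≤-trans y≤x x≤n)) y≤x

  ∈⇒≤sum : y ∈ xs → y ≤ sum xs
  ∈⇒≤sum {xs = x ∷ xs} (here refl) = m≤m+n x (sum xs)
  ∈⇒≤sum {xs = x ∷ xs} (there y∈) = ≤-trans (∈⇒≤sum y∈) (m≤n+m (sum xs) x)

  -- Letters needed by the pinnacles of a word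

  m+n≤o∧k≤i⇒m+k≤i+o : ∀ m {n o k i} → m + n ≤ o → k ≤ i → m + k ≤ i + o
  m+n≤o∧k≤i⇒m+k≤i+o m {n} {o} {k} {i} m+n≤o k≤i = begin
    m + k  ≤⟨ +-monoʳ-≤ m k≤i ⟩
    m + i  ≡⟨ +-comm m i ⟩
    i + m  ≤⟨ +-monoʳ-≤ i (m+n≤o⇒m≤o m m+n≤o) ⟩
    i + o  ∎
    where open ≤-Reasoning

  carried : ℕ → Bool → ℕ → ℕ
  carried x f a = if f then count≤ x (a ∷ []) else 0

  carried≤count : ∀ x f a → carried x f a ≤ count≤ x (a ∷ [])
  carried≤count x true  a = ≤-refl
  carried≤count x false a = z≤n

  opens+carried≡1 : ∀ f → a ≤ x → (if f then 0 else 1) + carried x f a ≡ 1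
  opens+carried≡1 true  a≤x = count≤-accept a≤x
  opens+carried≡1 false _   = refl

  -- The letters ≤ x pay for the pinnacles ≤ x, one right valley for each and one left valley
  -- for each block. With f = true a block is open, and the left valley of its next pinnacle
  -- is paid for by carried, i.e. by a.
  PinsBound : ℕ → Bool → ℕ → List ℕ → Set
  PinsBound x f a r =
    2 * count≤ x (pins (a ∷ r)) + blocksFrom (inSx x) f (pins (a ∷ r)) + carried x f a ≤ count≤ x (a ∷ r)

  +carried≤count≤-∷ : ∀ {m n} x f a → m + n ≤ count≤ x l → m + carried x f a ≤ count≤ x (a ∷ l)
  +carried≤count≤-∷ {l} {m} x f a bound =
    subst (m + carried x f a ≤_) (sym (count≤-++ x (a ∷ []) l))
          (m+n≤o∧k≤i⇒m+k≤i+o m bound (carried≤count x f a))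

  slope-bound : ∀ x f → pins (a ∷ b ∷ r) ≡ pins (b ∷ r) → PinsBound x f b r → PinsBound x f a (b ∷ r)
  slope-bound {a} {b} {r} x f pins≡ bound =
    subst (λ P → 2 * count≤ x P + blocksFrom (inSx x) f P + carried x f a ≤ count≤ x (a ∷ b ∷ r))
          (sym pins≡) (+carried≤count≤-∷ x f a bound)

  peak-bound : ∀ x f → a < b → c < b → PinsBound x true c r → PinsBound x false c r →
               PinsBound x f a (b ∷ c ∷ r)
  peak-bound {a} {b} {c} {r} x f a<b c<b inner outer with b ≤? x
  ... | yes b≤x = begin
    2 * count≤ x (pins (a ∷ b ∷ c ∷ r)) + blocksFrom (inSx x) f (pins (a ∷ b ∷ c ∷ r)) + carried x f a
      ≡⟨ cong (λ P → 2 * count≤ x P + blocksFrom (inSx x) f P + carried x f a) (pins-peak {r = r} a<b c<b) ⟩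
    2 * count≤ x (b ∷ P) + blocksFrom (inSx x) f (b ∷ P) + carried x f a
      ≡⟨ cong₂ (λ m k → 2 * m + k + carried x f a) (count≤-accept b≤x) (blocksFrom-≤ b≤x) ⟩
    2 * suc (count≤ x P) + ((if f then 0 else 1) + B) + carried x f a
      ≡⟨ regroup (count≤ x P) B (if f then 0 else 1) (carried x f a) ⟩
    2 + (2 * count≤ x P + B + ((if f then 0 else 1) + carried x f a))
      ≡⟨ cong (λ k → 2 + (2 * count≤ x P + B + k)) (trans (opens+carried≡1 f a≤x) (sym (count≤-accept c≤x))) ⟩
    2 + (2 * count≤ x P + B + carried x true c)
      ≤⟨ +-monoʳ-≤ 2 inner ⟩
    2 + count≤ x (c ∷ r)
      ≡⟨ trans (count≤-accept a≤x) (cong suc (count≤-accept b≤x)) ⟨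
    count≤ x (a ∷ b ∷ c ∷ r) ∎
    where
    open ≤-Reasoning
    P = pins (c ∷ r)
    B = blocksFrom (inSx x) true P
    a≤x = <⇒≤ (<-≤-trans a<b b≤x)
    c≤x = <⇒≤ (<-≤-trans c<b b≤x)
    regroup : ∀ p q j k → 2 * suc p + (j + q) + k ≡ 2 + (2 * p + q + (j + k))
    regroup = solve-∀
  ... | no b≰x = begin
    2 * count≤ x (pins (a ∷ b ∷ c ∷ r)) + blocksFrom (inSx x) f (pins (a ∷ b ∷ c ∷ r)) + carried x f a
      ≡⟨ cong (λ P → 2 * count≤ x P + blocksFrom (inSx x) f P + carried x f a) (pins-peak {r = r} a<b c<b) ⟩
    2 * count≤ x (b ∷ P) + blocksFrom (inSx x) f (b ∷ P) + carried x f a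
      ≡⟨ cong₂ (λ m k → 2 * m + k + carried x f a) (count≤-reject b≰x) (blocksFrom-≰ b≰x) ⟩
    2 * count≤ x P + blocksFrom (inSx x) false P + carried x f a
      ≤⟨ +carried≤count≤-∷ x f a outer′ ⟩
    count≤ x (a ∷ b ∷ c ∷ r) ∎
    where
    open ≤-Reasoning
    P = pins (c ∷ r)
    outer′ : 2 * count≤ x P + blocksFrom (inSx x) false P + 0 ≤ count≤ x (b ∷ c ∷ r)
    outer′ = ≤-trans outer (≤-reflexive (sym (count≤-reject b≰x)))

  pins-bound-∷ : ∀ x f a b c r → PinsBound x true c r → PinsBound x false c r →
                 PinsBound x f b (c ∷ r) → PinsBound x f a (b ∷ c ∷ r)
  pins-bound-∷ x f a b c r inner outer next with a <? b | c <? b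
  ... | yes a<b | yes c<b = peak-bound {r = r} x f a<b c<b inner outer
  ... | no  a≮b | _       = slope-bound {r = c ∷ r} x f (pins-notPeakˡ {r = r} a≮b) next
  ... | yes _   | no  c≮b = slope-bound {r = c ∷ r} x f (pins-notPeakʳ {a = a} {r = r} c≮b) next

  pins-bound : ∀ x f a r → PinsBound x f a r
  pins-bound x f a []          = +carried≤count≤-∷ x f a z≤n
  pins-bound x f a (b ∷ [])    = +carried≤count≤-∷ x f a z≤n
  pins-bound x f a (b ∷ c ∷ r) =
    pins-bound-∷ x f a b c r (pins-bound x true c r) (pins-bound x false c r) (pins-bound x f b (c ∷ r))

  pinnacle-count-bound : ∀ x w → 2 * count≤ x (pins w) + blocks (inSx x) (pins w) ≤ count≤ x w
  pinnacle-count-bound x []      = z≤n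
  pinnacle-count-bound x (a ∷ r) = subst (_≤ count≤ x (a ∷ r)) (+-identityʳ _) (pins-bound x false a r)

  -- Placing valleys below ceilings

  -- For pinnacles p₁ … pₖ in this order, the k + 1 valleys around them lie strictly
  -- below p₁, p₁ ⊓ p₂, …, pₖ₋₁ ⊓ pₖ, pₖ respectively.
  gapCeilings : ℕ → List ℕ → List ℕ
  gapCeilings p []       = p ∷ []
  gapCeilings p (b ∷ bs) = p ⊓ b ∷ gapCeilings b bs

  ceilings : ℕ → List ℕ → List ℕ
  ceilings a as = a ∷ gapCeilings a as

  ∈-gapCeilings⇒∈ : ∀ p bs → t ∈ gapCeilings p bs → t ∈ p ∷ bs
  ∈-gapCeilings⇒∈ p []       t∈          = t∈
  ∈-gapCeilings⇒∈ p (b ∷ bs) (here refl) with ⊓-sel p b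
  ... | inj₁ p⊓b≡p = here p⊓b≡p
  ... | inj₂ p⊓b≡b = there (here p⊓b≡b)
  ∈-gapCeilings⇒∈ p (b ∷ bs) (there t∈) = there (∈-gapCeilings⇒∈ b bs t∈)

  ∈-ceilings⇒∈ : ∀ a as → t ∈ ceilings a as → t ∈ a ∷ as
  ∈-ceilings⇒∈ a as (here refl) = here refl
  ∈-ceilings⇒∈ a as (there t∈)  = ∈-gapCeilings⇒∈ a as t∈

  ⊓-≰ : ¬ p ≤ t → ¬ b ≤ t → ¬ p ⊓ b ≤ t
  ⊓-≰ {p} {t} {b} p≰t b≰t with ⊓-sel p b
  ... | inj₁ p⊓b≡p = p≰t ∘ subst (_≤ t) p⊓b≡p
  ... | inj₂ p⊓b≡b = b≰t ∘ subst (_≤ t) p⊓b≡b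

  inSx-⊓ : ∀ t p b → inSx t (p ⊓ b) ≡ inSx t p ∨ inSx t b
  inSx-⊓ t p b with p ≤? t | b ≤? t
  ... | yes p≤t | _
    rewrite dec-true ((p ⊓ b) ≤? t) (m≤n⇒m⊓o≤n b p≤t) | dec-true (p ≤? t) p≤t = refl
  ... | no p≰t | yes b≤t
    rewrite dec-true ((p ⊓ b) ≤? t) (m≤n⇒o⊓m≤n p b≤t) | dec-false (p ≤? t) p≰t | dec-true (b ≤? t) b≤t = refl
  ... | no p≰t | no b≰t
    rewrite dec-false ((p ⊓ b) ≤? t) (⊓-≰ p≰t b≰t) | dec-false (p ≤? t) p≰t | dec-false (b ≤? t) b≰t = refl

  count≤-gapCeilings : ∀ t p bs →
    count≤ t (gapCeilings p bs) ≡ count≤ t (p ∷ bs) + blocksFrom (inSx t) (inSx t p) bs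
  count≤-gapCeilings t p []       = sym (+-identityʳ _)
  count≤-gapCeilings t p (b ∷ bs) = begin
    count≤ t (p ⊓ b ∷ gapCeilings b bs)
      ≡⟨ count≤-∷ t (p ⊓ b) _ ⟩
    indicator (inSx t (p ⊓ b)) + count≤ t (gapCeilings b bs)
      ≡⟨ cong₂ (λ B n → indicator B + n) (inSx-⊓ t p b) (count≤-gapCeilings t b bs) ⟩
    indicator (inSx t p ∨ inSx t b) + (count≤ t (b ∷ bs) + blocks′ (inSx t b))
      ≡⟨ cong (λ n → indicator (inSx t p ∨ inSx t b) + (n + blocks′ (inSx t b))) (count≤-∷ t b bs) ⟩
    indicator (inSx t p ∨ inSx t b) + (indicator (inSx t b) + count≤ t bs + blocks′ (inSx t b))
      ≡⟨ merge (inSx t p) (inSx t b) (count≤ t bs) ⟩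
    indicator (inSx t p) + (indicator (inSx t b) + count≤ t bs) +
      (if inSx t b then (if inSx t p then 0 else 1) + blocks′ true else blocks′ false)
      ≡⟨ cong₂ _+_ (cong (indicator (inSx t p) +_) (count≤-∷ t b bs)) (blocksFrom-∷ (inSx t) (inSx t p) b bs) ⟨
    indicator (inSx t p) + count≤ t (b ∷ bs) + blocksFrom (inSx t) (inSx t p) (b ∷ bs)
      ≡⟨ cong (_+ blocksFrom (inSx t) (inSx t p) (b ∷ bs)) (count≤-∷ t p (b ∷ bs)) ⟨
    count≤ t (p ∷ b ∷ bs) + blocksFrom (inSx t) (inSx t p) (b ∷ bs) ∎
    where
    open ≡-Reasoning
    blocks′ : Bool → ℕ
    blocks′ f = blocksFrom (inSx t) f bs
    merge : ∀ P B n → indicator (P ∨ B) + (indicator B + n + blocks′ B) ≡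
            indicator P + (indicator B + n) + (if B then (if P then 0 else 1) + blocks′ true else blocks′ false)
    merge true  true  n = refl
    merge true  false n = refl
    merge false true  n = cong suc (sym (+-suc n (blocks′ true)))
    merge false false n = refl

  count≤-ceilings : ∀ t a as → count≤ t (ceilings a as) ≡ count≤ t (a ∷ as) + blocks (inSx t) (a ∷ as)
  count≤-ceilings t a as = begin
    count≤ t (a ∷ gapCeilings a as)
      ≡⟨ count≤-∷ t a _ ⟩
    indicator (inSx t a) + count≤ t (gapCeilings a as)
      ≡⟨ cong (indicator (inSx t a) +_) (count≤-gapCeilings t a as) ⟩
    indicator (inSx t a) + (count≤ t (a ∷ as) + blocksFrom (inSx t) (inSx t a) as)
      ≡⟨ shuffle (inSx t a) (count≤ t (a ∷ as)) ⟩
    count≤ t (a ∷ as) + (if inSx t a then 1 + blocksFrom (inSx t) true as else blocksFrom (inSx t) false as)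
      ≡⟨ cong (count≤ t (a ∷ as) +_) (blocksFrom-∷ (inSx t) false a as) ⟨
    count≤ t (a ∷ as) + blocks (inSx t) (a ∷ as) ∎
    where
    open ≡-Reasoning
    shuffle : ∀ A n → indicator A + (n + blocksFrom (inSx t) A as) ≡
              n + (if A then 1 + blocksFrom (inSx t) true as else blocksFrom (inSx t) false as)
    shuffle true  n = sym (+-suc n _)
    shuffle false n = refl

  HallCondition : List ℕ → List ℕ → Set
  HallCondition cs U = ∀ t → t ∈ cs → count≤ t cs ≤ count< t U

  record Matching (cs U : List ℕ) : Set where
    constructor matching
    field
      below           : List ℕ
      rest            : List ℕ
      below<cs        : Pointwise _<_ below cs
      below++rest↭U   : below ++ rest ↭ U
      rest-increasing : Linked _<_ rest

  split-at-minimum : ∀ c cs → ∃ λ xs → ∃₂ λ m ys → c ∷ cs ≡ xs ++ m ∷ ys × All (m ≤_) (xs ++ ys)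
  split-at-minimum c []       = [] , c , [] , refl , []
  split-at-minimum c (d ∷ cs) with split-at-minimum d cs
  ... | xs , m , ys , d∷cs≡ , m≤ with c ≤? m
  ...   | yes c≤m = [] , c , d ∷ cs , refl ,
                    subst (All (c ≤_)) (sym d∷cs≡) (All.++⁺ (All.++⁻ˡ xs c≤) (c≤m ∷ All.++⁻ʳ xs c≤))
    where c≤ = All.map (≤-trans c≤m) m≤
  ...   | no  c≰m = c ∷ xs , m , ys , cong (c ∷_) d∷cs≡ , ≰⇒≥ c≰m ∷ m≤

  Pointwise-++⁻ : ∀ {R : ℕ → ℕ → Set} xs → Pointwise R vs (xs ++ ys) →
                  ∃₂ λ vs₁ vs₂ → vs ≡ vs₁ ++ vs₂ × Pointwise R vs₁ xs × Pointwise R vs₂ ys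
  Pointwise-++⁻ []       rs       = [] , _ , refl , [] , rs
  Pointwise-++⁻ (x ∷ xs) (r ∷ rs) with vs₁ , vs₂ , refl , rs₁ , rs₂ ← Pointwise-++⁻ xs rs =
    _ ∷ vs₁ , vs₂ , refl , r ∷ rs₁ , rs₂

  hall-at-minimum : ∀ xs → HallCondition (xs ++ c ∷ ys) U → 0 < count< c U
  hall-at-minimum {c} {ys} xs hall =
    <-≤-trans (subst (0 <_) (sym (count≤-insert {ys = ys} xs ≤-refl)) z<s) (hall c (∈-++⁺ʳ xs (here refl)))

  hall-remove-minimum : ∀ xs → HallCondition (xs ++ c ∷ ys) (u ∷ U) → All (c ≤_) (xs ++ ys) →
                        HallCondition (xs ++ ys) U
  hall-remove-minimum {c} {ys} {u} {U} xs hall c≤ t t∈ = ≤-pred (begin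
    suc (count≤ t (xs ++ ys))  ≡⟨ count≤-insert xs (All.lookup c≤ t∈) ⟨
    count≤ t (xs ++ c ∷ ys)    ≤⟨ hall t (∈-resp-↭ (↭-sym (shift c xs ys)) (there t∈)) ⟩
    count< t (u ∷ U)           ≤⟨ count<-∷ t u U ⟩
    suc (count< t U)           ∎)
    where open ≤-Reasoning

  -- The smallest ceiling takes the smallest available value; Hall's condition at that
  -- ceiling guarantees the value fits, and survives the removal of both.
  match : ∀ cs → Linked _<_ U → HallCondition cs U → Matching cs U
  match-minimum : ∀ xs c ys → Linked _<_ U → HallCondition (xs ++ c ∷ ys) U →
                  All (c ≤_) (xs ++ ys) → Matching (xs ++ c ∷ ys) U

  match {U} [] U↑ _ = matching [] U [] ↭-refl U↑
  match {U} (c₀ ∷ cs) U↑ hall with xs , c , ys , split , c≤ ← split-at-minimum c₀ cs =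
    subst (λ cs → Matching cs U) (sym split)
          (match-minimum xs c ys U↑ (subst (λ cs → HallCondition cs U) split hall) c≤)

  match-minimum {[]} xs c ys _ hall _ = ⊥-elim (<-irrefl refl (hall-at-minimum {U = []} xs hall))
  match-minimum {u ∷ U} xs c ys U↑ hall c≤ with u <? c
  ... | no u≮c = ⊥-elim (<-irrefl refl (subst (0 <_) (count<-increasing u≮c U↑) (hall-at-minimum {U = u ∷ U} xs hall)))
  ... | yes u<c with match (xs ++ ys) (Linked.tail U↑) (hall-remove-minimum xs hall c≤)
  ...   | matching below rest below< below++rest↭ rest↑ with Pointwise-++⁻ xs below<
  ...     | below₁ , below₂ , refl , below₁< , below₂< =
    matching (below₁ ++ u ∷ below₂) rest (Pointwise.++⁺ below₁< (u<c ∷ below₂<)) perm rest↑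
    where
    open PermutationReasoning
    perm : (below₁ ++ u ∷ below₂) ++ rest ↭ u ∷ U
    perm = begin
      (below₁ ++ u ∷ below₂) ++ rest  ≡⟨ ++-assoc below₁ (u ∷ below₂) rest ⟩
      below₁ ++ u ∷ below₂ ++ rest    ↭⟨ shift u below₁ (below₂ ++ rest) ⟩
      u ∷ below₁ ++ below₂ ++ rest    ≡⟨ cong (u ∷_) (++-assoc below₁ below₂ rest) ⟨
      u ∷ (below₁ ++ below₂) ++ rest  ↭⟨ prep u below++rest↭ ⟩
      u ∷ U                           ∎

  -- v₀ ∷ weave p₁ (p₂ ∷ … ∷ pₖ) (v₁ ∷ … ∷ vₖ) rest is the word v₀ p₁ v₁ p₂ … pₖ vₖ followed by rest.
  weave : ℕ → List ℕ → List ℕ → List ℕ → List ℕ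
  weave p []       vs       rest = p ∷ vs ++ rest
  weave p (b ∷ bs) []       rest = p ∷ rest
  weave p (b ∷ bs) (v ∷ vs) rest = p ∷ v ∷ weave b bs vs rest

  pins-weave : ∀ {v₀ p rest} bs → v₀ < p → Pointwise _<_ vs (gapCeilings p bs) → Linked _<_ rest →
               pins (v₀ ∷ weave p bs vs rest) ≡ p ∷ bs
  pins-weave {rest = rest} [] v₀<p (v<p ∷ []) rest↑ =
    trans (pins-peak {r = rest} v₀<p v<p) (cong (_ ∷_) (pins-increasing rest↑))
  pins-weave {v ∷ vs} {p = p} {rest} (b ∷ bs) v₀<p (v<p⊓b ∷ vs<) rest↑ =
    trans (pins-peak {r = weave b bs vs rest} v₀<p (<-≤-trans v<p⊓b (m⊓n≤m p b)))
          (cong (p ∷_) (pins-weave bs (<-≤-trans v<p⊓b (m⊓n≤n p b)) vs< rest↑))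

  weave-↭ : ∀ {p rest} bs → Pointwise _<_ vs (gapCeilings p bs) → weave p bs vs rest ↭ (p ∷ bs) ++ vs ++ rest
  weave-↭ []       _         = ↭-refl
  weave-↭ {v ∷ vs} {p} {rest} (b ∷ bs) (_ ∷ vs<) =
    prep p (↭-trans (prep v (weave-↭ bs vs<)) (↭-sym (shift v (b ∷ bs) (vs ++ rest))))

  +[n∸1]≤m-s-1⇔s+n≤m : ∀ n s m → 1 ≤ n → (ℤ.+ (n ∸ 1) ℤ.≤ ℤ.+ m ℤ.- ℤ.+ s ℤ.- ℤ.+ 1) ⇔ (s + n ≤ m)
  +[n∸1]≤m-s-1⇔s+n≤m (suc n) s m _ = mk⇔ to from
    where
    open ℤ.≤-Reasoning
    to : ℤ.+ n ℤ.≤ ℤ.+ m ℤ.- ℤ.+ s ℤ.- ℤ.+ 1 → s + suc n ≤ m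
    to n≤ = ℤ.drop‿+≤+ (begin
      ℤ.+ (s + suc n)                                  ≡⟨ cong ℤ.+_ (reorder s n) ⟩
      ℤ.+ n ℤ.+ ℤ.+ 1 ℤ.+ ℤ.+ s                          ≤⟨ ℤ.+-monoˡ-≤ (ℤ.+ s) (ℤ.+-monoˡ-≤ (ℤ.+ 1) n≤) ⟩
      ℤ.+ m ℤ.- ℤ.+ s ℤ.- ℤ.+ 1 ℤ.+ ℤ.+ 1 ℤ.+ ℤ.+ s    ≡⟨ cancel (ℤ.+ m) (ℤ.+ s) ⟩
      ℤ.+ m                                            ∎)
      where
      reorder : ∀ s n → s + suc n ≡ n + 1 + s
      reorder = solve-∀
      cancel : ∀ M S → M ℤ.- S ℤ.- ℤ.+ 1 ℤ.+ ℤ.+ 1 ℤ.+ S ≡ M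
      cancel = ℤ-Solver.solve-∀
    from : s + suc n ≤ m → ℤ.+ n ℤ.≤ ℤ.+ m ℤ.- ℤ.+ s ℤ.- ℤ.+ 1
    from s+n≤m = begin
      ℤ.+ n                                ≡⟨ cancel (ℤ.+ s) (ℤ.+ n) ⟨
      ℤ.+ (s + suc n) ℤ.- ℤ.+ s ℤ.- ℤ.+ 1  ≤⟨ ℤ.+-monoˡ-≤ (ℤ.- ℤ.+ 1) (ℤ.+-monoˡ-≤ (ℤ.- ℤ.+ s) (ℤ.+≤+ s+n≤m)) ⟩
      ℤ.+ m ℤ.- ℤ.+ s ℤ.- ℤ.+ 1            ∎
      where
      cancel : ∀ S N → S ℤ.+ (ℤ.+ 1 ℤ.+ N) ℤ.- S ℤ.- ℤ.+ 1 ≡ N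
      cancel = ℤ-Solver.solve-∀

  interruptions≤kx⇔ : ∀ {S A} → A ↭ S → x ∈ S →
    (ℤ.+ interruptions (inSx x) A ℤ.≤ kx S x) ⇔ (cardSx S x + blocks (inSx x) A ≤ cardSbarx S x)
  interruptions≤kx⇔ A↭S x∈S =
    +[n∸1]≤m-s-1⇔s+n≤m _ _ _ (blocks-pos (∈-resp-↭ (↭-sym A↭S) x∈S) ≤-refl)

  module _ {S : List ℕ} (S-unique : Unique S) (S-admissible : AdmissiblePinnacleSet S) where

    S-positive : y ∈ S → 1 ≤ y
    S-positive y∈S =
      let n , w , w↭ , pins⇔ = S-admissible
      in proj₁ (∈-interval⁻ (∈-resp-↭ w↭ (∈-pins⇒∈ w (Equivalence.from (pins⇔ _) y∈S))))

    cardSx+cardSbarx : ∀ x → cardSx S x + cardSbarx S x ≡ x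
    cardSx+cardSbarx x = begin
      cardSx S x + cardSbarx S x
        ≡⟨ cong (_+ cardSbarx S x) (↭-length pinnacles↭) ⟨
      length (filter (_∈? S) (interval x)) + cardSbarx S x
        ≡⟨ length-++ (filter (_∈? S) (interval x)) ⟨
      length (filter (_∈? S) (interval x) ++ filter (λ y → ¬? (y ∈? S)) (interval x))
        ≡⟨ ↭-length (filter-partition-↭ (_∈? S) (interval x)) ⟨
      length (interval x)
        ≡⟨ length-interval x ⟩
      x ∎
      where
      open ≡-Reasoning
      pinnacles↭ : filter (_∈? S) (interval x) ↭ filter (_≤? x) S
      pinnacles↭ = unique-↭ (Unique.filter⁺ (_∈? S) (interval-unique x)) (Unique.filter⁺ (_≤? x) S-unique)
                            (mk⇔ to from)
        where
        to : y ∈ filter (_∈? S) (interval x) → y ∈ filter (_≤? x) S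
        to y∈ with y∈I , y∈S ← ∈-filter⁻ (_∈? S) {xs = interval x} y∈ =
          ∈-filter⁺ (_≤? x) y∈S (proj₂ (∈-interval⁻ y∈I))
        from : y ∈ filter (_≤? x) S → y ∈ filter (_∈? S) (interval x)
        from y∈ with y∈S , y≤x ← ∈-filter⁻ (_≤? x) {xs = S} y∈ =
          ∈-filter⁺ (_∈? S) (∈-interval⁺ (S-positive y∈S) y≤x) y∈S

    admissible⇒bound : ∀ {A} → AdmissibleOrdering A → A ↭ S → x ∈ S →
                       cardSx S x + blocks (inSx x) A ≤ cardSbarx S x
    admissible⇒bound {x} {A} (n , w , w↭ , pins≡A) A↭S x∈S = +-cancelˡ-≤ (cardSx S x) _ _ (begin
      cardSx S x + (cardSx S x + blocks (inSx x) A)      ≡⟨ double (cardSx S x) _ ⟩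
      2 * cardSx S x + blocks (inSx x) A                 ≡⟨ cong (λ k → 2 * k + blocks (inSx x) A) (count≤-↭ A↭S) ⟨
      2 * count≤ x A + blocks (inSx x) A                 ≡⟨ cong (λ P → 2 * count≤ x P + blocks (inSx x) P) pins≡A ⟨
      2 * count≤ x (pins w) + blocks (inSx x) (pins w)   ≤⟨ pinnacle-count-bound x w ⟩
      count≤ x w                                         ≡⟨ count≤-↭ w↭ ⟩
      count≤ x (interval n)                              ≡⟨ count≤-interval x≤n ⟩
      x                                                  ≡⟨ cardSx+cardSbarx x ⟨
      cardSx S x + cardSbarx S x                         ∎)
      where
      open ≤-Reasoning
      double : ∀ s b → s + (s + b) ≡ 2 * s + b
      double = solve-∀
      x∈w = ∈-pins⇒∈ w (subst (x ∈_) (sym pins≡A) (∈-resp-↭ (↭-sym A↭S) x∈S))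
      x≤n = proj₂ (∈-interval⁻ (∈-resp-↭ w↭ x∈w))

    N : ℕ
    N = sum S

    nonPinnacles : List ℕ
    nonPinnacles = filter (λ y → ¬? (y ∈? S)) (interval N)

    nonPinnacles-increasing : Linked _<_ nonPinnacles
    nonPinnacles-increasing = Linked.filter⁺ (λ y → ¬? (y ∈? S)) <-trans (interval-increasing N)

    interval↭S++nonPinnacles : interval N ↭ S ++ nonPinnacles
    interval↭S++nonPinnacles =
      ↭-trans (filter-partition-↭ (_∈? S) (interval N)) (++⁺ʳ nonPinnacles pinnacles↭)
      where
      pinnacles↭ : filter (_∈? S) (interval N) ↭ S
      pinnacles↭ = unique-↭ (Unique.filter⁺ (_∈? S) (interval-unique N)) S-unique (mk⇔
        (λ y∈ → proj₂ (∈-filter⁻ (_∈? S) {xs = interval N} y∈))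
        (λ y∈S → ∈-filter⁺ (_∈? S) (∈-interval⁺ (S-positive y∈S) (∈⇒≤sum y∈S)) y∈S))

    cardSbarx≡count< : t ∈ S → cardSbarx S t ≡ count< t nonPinnacles
    cardSbarx≡count< {t} t∈S = ↭-length (unique-↭
      (Unique.filter⁺ (λ y → ¬? (y ∈? S)) (interval-unique t))
      (Unique.filter⁺ (_<? t) (Unique.filter⁺ (λ y → ¬? (y ∈? S)) (interval-unique N)))
      (mk⇔ to from))
      where
      to : y ∈ filter (λ y → ¬? (y ∈? S)) (interval t) → y ∈ filter (_<? t) nonPinnacles
      to y∈ =
        let y∈I , y∉S = ∈-filter⁻ (λ y → ¬? (y ∈? S)) {xs = interval t} y∈
            1≤y , y≤t = ∈-interval⁻ y∈I
        in ∈-filter⁺ (_<? t) (∈-filter⁺ (λ y → ¬? (y ∈? S)) (∈-interval⁺ 1≤y (≤-trans y≤t (∈⇒≤sum t∈S))) y∉S)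
                     (≤∧≢⇒< y≤t (λ { refl → y∉S t∈S }))
      from : y ∈ filter (_<? t) nonPinnacles → y ∈ filter (λ y → ¬? (y ∈? S)) (interval t)
      from y∈ =
        let y∈U , y<t = ∈-filter⁻ (_<? t) {xs = nonPinnacles} y∈
            y∈I , y∉S = ∈-filter⁻ (λ y → ¬? (y ∈? S)) {xs = interval N} y∈U
        in ∈-filter⁺ (λ y → ¬? (y ∈? S)) (∈-interval⁺ (proj₁ (∈-interval⁻ y∈I)) (<⇒≤ y<t)) y∉S

    bound⇒admissible : ∀ A → A ↭ S → (∀ x → x ∈ S → cardSx S x + blocks (inSx x) A ≤ cardSbarx S x) →
                       AdmissibleOrdering A
    bound⇒admissible []       _   _     = 0 , [] , ↭-refl , refl
    bound⇒admissible (a ∷ as) A↭S bound with match (ceilings a as) nonPinnacles-increasing hall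
      where
      hall : HallCondition (ceilings a as) nonPinnacles
      hall t t∈ = begin
        count≤ t (ceilings a as)                      ≡⟨ count≤-ceilings t a as ⟩
        count≤ t (a ∷ as) + blocks (inSx t) (a ∷ as)  ≡⟨ cong (_+ blocks (inSx t) (a ∷ as)) (count≤-↭ A↭S) ⟩
        cardSx S t + blocks (inSx t) (a ∷ as)         ≤⟨ bound t t∈S ⟩
        cardSbarx S t                                 ≡⟨ cardSbarx≡count< t∈S ⟩
        count< t nonPinnacles                         ∎
        where
        open ≤-Reasoning
        t∈S = ∈-resp-↭ A↭S (∈-ceilings⇒∈ a as t∈)
    ... | matching (v₀ ∷ vs) rest (v₀<a ∷ vs<) valleys↭ rest↑ =
      N , v₀ ∷ weave a as vs rest , w↭ , pins-weave as v₀<a vs< rest↑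
      where
      open PermutationReasoning
      w↭ : v₀ ∷ weave a as vs rest ↭ interval N
      w↭ = begin
        v₀ ∷ weave a as vs rest      ↭⟨ prep v₀ (weave-↭ as vs<) ⟩
        v₀ ∷ (a ∷ as) ++ vs ++ rest  ↭⟨ shift v₀ (a ∷ as) (vs ++ rest) ⟨
        (a ∷ as) ++ v₀ ∷ vs ++ rest  ↭⟨ ++⁺ A↭S valleys↭ ⟩
        S ++ nonPinnacles            ↭⟨ interval↭S++nonPinnacles ⟨
        interval N                   ∎

open import Defs
open import Data.Nat using (ℕ)
open import Data.Integer using (+_; _≤_)
open import Data.List using (List)
open import Data.List.Relation.Unary.Unique.Propositional using (Unique)
open import Data.List.Relation.Binary.Permutation.Propositional using (_↭_)
open import Data.List.Membership.Propositional using (_∈_)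
open import Function.Bundles using (_⇔_; mk⇔; Equivalence)
open PinnacleOrderings using (interruptions≤kx⇔; admissible⇒bound; bound⇒admissible)

theorem3p6 : (S : List ℕ) → Unique S → AdmissiblePinnacleSet S →
    (A : List ℕ) → A ↭ S →
    AdmissibleOrdering A ⇔ (∀ x → x ∈ S → + interruptions (inSx x) A ≤ kx S x)
theorem3p6 S S-unique S-admissible A A↭S = mk⇔
  (λ A-admissible x x∈S → Equivalence.from (interruptions≤kx⇔ A↭S x∈S)
      (admissible⇒bound S-unique S-admissible A-admissible A↭S x∈S))
  (λ bounds → bound⇒admissible S-unique S-admissible A A↭S
      (λ x x∈S → Equivalence.to (interruptions≤kx⇔ A↭S x∈S) (bounds x x∈S)))
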